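{- Let $n\ge 2$ and consider a partial coloring of an $n\times n$ square $A$ with colors from $\{1,2,\dots,2n-2\}$. If this partial coloring uniquely extends to $L(n,2n-2)$, then there are no rows $i\neq i'$ and columns $j\neq j'$ such that the four entries $(i,j),(i,j'),(i',j),(i',j')$ are all uncolored.
   Context: Entry $(i,j)$ is the entry in row $i$ and column $j$. An $L(n,k)$ is an $n\times n$ square all of whose entries are colored with colors from a set of $k$ colors so that all entries in a common row, and all entries in a common column, have pairwise different colors. A partial coloring of an $n\times n$ square assigns colors (from the $k$ colors) to some of its entries; the remaining entries are uncolored. A partial coloring uniquely extends to $L(n,k)$ if there is exactly one way to color the uncolored entries so that the resulting fully colored square is an $L(n,k)$. -}

module Defs where

open import Data.Nat using (ℕ)
open import Data.Fin using (Fin)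
open import Data.Maybe using (Maybe; just; nothing)
open import Data.Product using (Σ; _×_)
open import Relation.Binary.PropositionalEquality using (_≡_; _≢_)

Coloring : ℕ → ℕ → Set
Coloring n k = Fin n → Fin n → Fin k

-- A partial coloring: `nothing` means the entry is uncolored.
PartialColoring : ℕ → ℕ → Set
PartialColoring n k = Fin n → Fin n → Maybe (Fin k)

IsL : {n k : ℕ} → Coloring n k → Set
IsL {n} C =
  (∀ (i j j' : Fin n) → j ≢ j' → C i j ≢ C i j') ×
  (∀ (i i' j : Fin n) → i ≢ i' → C i j ≢ C i' j)

Extends : {n k : ℕ} → PartialColoring n k → Coloring n k → Set
Extends {n} {k} P C = ∀ (i j : Fin n) (c : Fin k) → P i j ≡ just c → C i j ≡ c

UniquelyExtends : {n k : ℕ} → PartialColoring n k → Set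
UniquelyExtends {n} {k} P =
  Σ (Coloring n k) (λ C → Extends P C × IsL C) ×
  (∀ (C D : Coloring n k) → Extends P C → IsL C → Extends P D → IsL D →
     ∀ (i j : Fin n) → C i j ≡ D i j)

module Submission where

-- A new colour for a corner only has to avoid the rest of its row except
-- the entry in the other column of the rectangle (n − 1 cells) and the rest of its column
-- outside the rectangle (n − 2 cells); as 2n − 3 < 2n − 2, every corner has such a fresh
-- colour y. If some corner's y differs from the colours of its two neighbouring corners,
-- recolouring that corner alone gives another L(n, 2n − 2); otherwise every y equals a
-- neighbouring colour, and then recolouring all four corners by y is proper. Either way
-- P has a second extension.

open import Defs
open import Data.Nat using (ℕ; suc; _+_; _*_; _∸_; _<_; _≤_; s≤s; z≤n)
open import Data.Nat.Properties using (+-identityʳ; +-suc; ≤-refl)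
open import Data.Bool using (Bool; true; false; not; _∧_; if_then_else_)
import Data.Bool.Properties as Bool
open import Data.Fin using (Fin; punchIn; punchOut; _↑ˡ_; _↑ʳ_)
open import Data.Fin.Properties
  using (_≟_; any?; ¬∀⟶∃¬; <⇒notInjective; punchIn-punchOut)
open import Data.Vec.Functional using (_++_)
open import Data.Vec.Functional.Properties using (lookup-++ˡ; lookup-++ʳ)
open import Data.Maybe using (Maybe; just; nothing)
open import Data.Product using (Σ; ∃; ∃₂; _×_; _,_; proj₁; proj₂; map₂)
open import Data.Sum using (_⊎_; inj₁; inj₂)
open import Data.Empty using (⊥; ⊥-elim)
open import Function using (_∘_)
open import Relation.Binary.PropositionalEquality
  using (_≡_; _≢_; refl; sym; trans; cong; cong₂; subst; module ≡-Reasoning)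
open import Relation.Nullary using (¬_; Dec; yes; no; does)
open import Relation.Nullary.Decidable using (_⊎-dec_)

missing-value : ∀ {m k} (f : Fin m → Fin k) → m < k → ∃ λ x → ∀ z → f z ≢ x
missing-value {m} {k} f m<k =
  map₂ (λ unhit z fz≡x → unhit (z , fz≡x))
       (¬∀⟶∃¬ k (λ x → ∃ λ z → f z ≡ x) (λ x → any? (λ z → f z ≟ x)) not-surjective)
  where
  not-surjective : ¬ (∀ x → ∃ λ z → f z ≡ x)
  not-surjective hit = <⇒notInjective m<k section-injective
    where
    section-injective : ∀ {x y} → proj₁ (hit x) ≡ proj₁ (hit y) → x ≡ y
    section-injective {x} {y} eq =
      trans (sym (proj₂ (hit x))) (trans (cong f eq) (proj₂ (hit y)))

punchIn-onto : ∀ {n} {i j : Fin (suc n)} → j ≢ i → ∃ λ u → punchIn i u ≡ j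
punchIn-onto j≢i = punchOut (j≢i ∘ sym) , punchIn-punchOut (j≢i ∘ sym)

punchIn₂-onto : ∀ {n} {i i' j : Fin (suc (suc n))} (i≢i' : i ≢ i') → j ≢ i → j ≢ i' →
                ∃ λ v → punchIn i (punchIn (punchOut i≢i') v) ≡ j
punchIn₂-onto {i = i} i≢i' j≢i j≢i' with u , i↑u≡j ← punchIn-onto j≢i
  with v , i'↑v≡u ← punchIn-onto {j = u} (λ u≡i' →
         j≢i' (trans (sym i↑u≡j) (trans (cong (punchIn i) u≡i') (punchIn-punchOut i≢i'))))
  = v , trans (cong (punchIn i) i'↑v≡u) i↑u≡j

fresh-colour : ∀ {m k} (C : Coloring (suc (suc m)) k) → suc m + m < k →
               ∀ r t₀ c {s₁ s₂} → s₁ ≢ s₂ →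
               ∃ λ x → (∀ t → t ≢ t₀ → C r t ≢ x) × (∀ s → s ≢ s₁ → s ≢ s₂ → C s c ≢ x)
fresh-colour {m} {k} C 2n∸3<k r t₀ c {s₁} {s₂} s₁≢s₂ = x , off-row , off-column
  where
  row-colours : Fin (suc m) → Fin k
  row-colours u = C r (punchIn t₀ u)
  column-colours : Fin m → Fin k
  column-colours v = C (punchIn s₁ (punchIn (punchOut s₁≢s₂) v)) c
  missing : ∃ λ x → ∀ z → (row-colours ++ column-colours) z ≢ x
  missing = missing-value (row-colours ++ column-colours) 2n∸3<k
  x : Fin k
  x = proj₁ missing
  off-row : ∀ t → t ≢ t₀ → C r t ≢ x
  off-row t t≢t₀ Crt≡x with u , t₀↑u≡t ← punchIn-onto t≢t₀ =
    proj₂ missing (u ↑ˡ m)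
      (trans (lookup-++ˡ row-colours column-colours u)
             (subst (λ t → C r t ≡ x) (sym t₀↑u≡t) Crt≡x))
  off-column : ∀ s → s ≢ s₁ → s ≢ s₂ → C s c ≢ x
  off-column s s≢s₁ s≢s₂ Csc≡x with v , ↑v≡s ← punchIn₂-onto s₁≢s₂ s≢s₁ s≢s₂ =
    proj₂ missing (suc m ↑ʳ v)
      (trans (lookup-++ʳ row-colours column-colours v)
             (subst (λ s → C s c ≡ x) (sym ↑v≡s) Csc≡x))

IsL₂ : ∀ {k} → (Bool → Bool → Fin k) → Set
IsL₂ V = (∀ a → V a true ≢ V a false) × (∀ b → V true b ≢ V false b)

Recolouring : ∀ {k} → (c y : Bool → Bool → Fin k) → Set
Recolouring {k} c y = Σ (Bool → Bool → Fin k) λ V → IsL₂ V ×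
  (∀ a b → V a b ≡ c a b ⊎ V a b ≡ y a b) × ∃₂ λ a b → V a b ≡ y a b

module _ {k} {c y : Bool → Bool → Fin k} (c-L : IsL₂ c) (y≢c : ∀ a b → y a b ≢ c a b) where

  Blocked : Bool → Bool → Set
  Blocked a b = y a b ≡ c a (not b) ⊎ y a b ≡ c (not a) b

  recolour : (Bool → Bool → Bool) → Bool → Bool → Fin k
  recolour S a b = if S a b then y a b else c a b

  recolour-choice : ∀ S a b → recolour S a b ≡ c a b ⊎ recolour S a b ≡ y a b
  recolour-choice S a b with S a b
  ... | true  = inj₂ refl
  ... | false = inj₁ refl

  only : Bool → Bool → Bool → Bool → Bool
  only a₀ b₀ a b = does (a Bool.≟ a₀) ∧ does (b Bool.≟ b₀)

  recolour-only-isL₂ : ∀ a₀ b₀ → ¬ Blocked a₀ b₀ → IsL₂ (recolour (only a₀ b₀))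
  recolour-only-isL₂ a₀ b₀ free = rows a₀ b₀ free , columns a₀ b₀ free
    where
    rows : ∀ a₀ b₀ → ¬ Blocked a₀ b₀ →
           ∀ a → recolour (only a₀ b₀) a true ≢ recolour (only a₀ b₀) a false
    rows true  true  free true  = free ∘ inj₁
    rows true  false free true  = free ∘ inj₁ ∘ sym
    rows false true  free false = free ∘ inj₁
    rows false false free false = free ∘ inj₁ ∘ sym
    rows true  true  _    false = proj₁ c-L false
    rows true  false _    false = proj₁ c-L false
    rows false true  _    true  = proj₁ c-L true
    rows false false _    true  = proj₁ c-L true
    columns : ∀ a₀ b₀ → ¬ Blocked a₀ b₀ →
              ∀ b → recolour (only a₀ b₀) true b ≢ recolour (only a₀ b₀) false b
    columns true  true  free true  = free ∘ inj₂
    columns false true  free true  = free ∘ inj₂ ∘ sym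
    columns true  false free false = free ∘ inj₂
    columns false false free false = free ∘ inj₂ ∘ sym
    columns true  true  _    false = proj₂ c-L false
    columns false true  _    false = proj₂ c-L false
    columns true  false _    true  = proj₂ c-L true
    columns false false _    true  = proj₂ c-L true

  recolour-only-self : ∀ a₀ b₀ → recolour (only a₀ b₀) a₀ b₀ ≡ y a₀ b₀
  recolour-only-self true  true  = refl
  recolour-only-self true  false = refl
  recolour-only-self false true  = refl
  recolour-only-self false false = refl

  all-blocked-isL₂ : (∀ a b → Blocked a b) → IsL₂ y
  all-blocked-isL₂ blocked = rows , columns
    where
    rows : ∀ a → y a true ≢ y a false
    rows a e with blocked a true | blocked a false
    ... | inj₁ e₁ | _       = y≢c a false (trans (sym e) e₁)
    ... | inj₂ e₁ | inj₁ e₂ = y≢c a true (trans e e₂)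
    ... | inj₂ e₁ | inj₂ e₂ = proj₁ c-L (not a) (trans (sym e₁) (trans e e₂))
    columns : ∀ b → y true b ≢ y false b
    columns b e with blocked true b | blocked false b
    ... | inj₂ e₁ | _       = y≢c false b (trans (sym e) e₁)
    ... | inj₁ e₁ | inj₂ e₂ = y≢c true b (trans e e₂)
    ... | inj₁ e₁ | inj₁ e₂ = proj₂ c-L (not b) (trans (sym e₁) (trans e e₂))

  recolouring-only : ∀ a₀ b₀ → ¬ Blocked a₀ b₀ → Recolouring c y
  recolouring-only a₀ b₀ free =
    recolour (only a₀ b₀) , recolour-only-isL₂ a₀ b₀ free , recolour-choice (only a₀ b₀) ,
    a₀ , b₀ , recolour-only-self a₀ b₀

  blocked? : ∀ a b → Dec (Blocked a b)
  blocked? a b = (y a b ≟ c a (not b)) ⊎-dec (y a b ≟ c (not a) b)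

  recolouring : Recolouring c y
  recolouring with blocked? true true | blocked? true false | blocked? false true | blocked? false false
  ... | no free | _ | _ | _ = recolouring-only true true free
  ... | yes _ | no free | _ | _ = recolouring-only true false free
  ... | yes _ | yes _ | no free | _ = recolouring-only false true free
  ... | yes _ | yes _ | yes _ | no free = recolouring-only false false free
  ... | yes b₁ | yes b₂ | yes b₃ | yes b₄ =
    y , all-blocked-isL₂ blocked , (λ _ _ → inj₂ refl) , true , true , refl
    where
    blocked : ∀ a b → Blocked a b
    blocked true  true  = b₁
    blocked true  false = b₂
    blocked false true  = b₃
    blocked false false = b₄

IsL₂-row : ∀ {k} {V : Bool → Bool → Fin k} → IsL₂ V → ∀ a {b b'} → b ≢ b' → V a b ≢ V a b'
IsL₂-row V-L a {true}  {true}  b≢b' = ⊥-elim (b≢b' refl)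
IsL₂-row V-L a {true}  {false} _    = proj₁ V-L a
IsL₂-row V-L a {false} {true}  _    = proj₁ V-L a ∘ sym
IsL₂-row V-L a {false} {false} b≢b' = ⊥-elim (b≢b' refl)

IsL₂-column : ∀ {k} {V : Bool → Bool → Fin k} → IsL₂ V → ∀ b {a a'} → a ≢ a' → V a b ≢ V a' b
IsL₂-column V-L b {true}  {true}  a≢a' = ⊥-elim (a≢a' refl)
IsL₂-column V-L b {true}  {false} _    = proj₂ V-L b
IsL₂-column V-L b {false} {true}  _    = proj₂ V-L b ∘ sym
IsL₂-column V-L b {false} {false} a≢a' = ⊥-elim (a≢a' refl)

locate : ∀ {n} → (Bool → Fin n) → Fin n → Maybe Bool
locate r x with x ≟ r true | x ≟ r false
... | yes _ | _     = just true
... | no _  | yes _ = just false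
... | no _  | no _  = nothing

locate-just : ∀ {n} (r : Bool → Fin n) x {a} → locate r x ≡ just a → x ≡ r a
locate-just r x e with x ≟ r true | x ≟ r false
locate-just r x refl | yes x≡r₁ | _         = x≡r₁
locate-just r x refl | no _     | yes x≡r₀  = x≡r₀

locate-nothing : ∀ {n} (r : Bool → Fin n) x → locate r x ≡ nothing → ∀ a → x ≢ r a
locate-nothing r x e a with x ≟ r true | x ≟ r false
locate-nothing r x e true  | no x≢r₁ | no _     = x≢r₁
locate-nothing r x e false | no _    | no x≢r₀  = x≢r₀

locate-self : ∀ {n} (r : Bool → Fin n) → r true ≢ r false → ∀ a → locate r (r a) ≡ just a
locate-self r r₁≢r₀ true with r true ≟ r true
... | yes _   = refl
... | no r≢r  = ⊥-elim (r≢r refl)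
locate-self r r₁≢r₀ false with r false ≟ r true | r false ≟ r false
... | yes r₀≡r₁ | _      = ⊥-elim (r₁≢r₀ (sym r₀≡r₁))
... | no _      | yes _  = refl
... | no _      | no r≢r = ⊥-elim (r≢r refl)

onCorner : {A : Set} → Maybe Bool → Maybe Bool → (Bool → Bool → A) → A → A
onCorner (just a) (just b) V _ = V a b
onCorner _        _        _ x = x

module Rectangle {n} (row col : Bool → Fin n)
                 (row-distinct : row true ≢ row false) (col-distinct : col true ≢ col false) where

  patch : ∀ {k} → Coloring n k → (Bool → Bool → Fin k) → Coloring n k
  patch C V s t = onCorner (locate row s) (locate col t) V (C s t)

  patch-corner : ∀ {k} (C : Coloring n k) V a b → patch C V (row a) (col b) ≡ V a b
  patch-corner C V a b rewrite locate-self row row-distinct a | locate-self col col-distinct b = refl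

  Compatible : ∀ {k} → Coloring n k → (Bool → Bool → Fin k) → Set
  Compatible C V = (∀ a b t → (∀ b' → t ≢ col b') → V a b ≢ C (row a) t)
                 × (∀ a b s → (∀ a' → s ≢ row a') → V a b ≢ C s (col b))

  patch-isL : ∀ {k} {C : Coloring n k} {V} → IsL C → IsL₂ V → Compatible C V → IsL (patch C V)
  patch-isL {C = C} {V} C-L V-L (row-compatible , column-compatible) = rows , columns
    where
    rows : ∀ s t t' → t ≢ t' → patch C V s t ≢ patch C V s t'
    rows s t t' t≢t' with locate row s in es | locate col t in et | locate col t' in et'
    ... | nothing | _       | _       = proj₁ C-L s t t' t≢t'
    ... | just a  | nothing | nothing = proj₁ C-L s t t' t≢t'
    ... | just a  | just b  | nothing = λ e →
      row-compatible a b t' (locate-nothing col t' et')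
        (trans e (cong (λ s → C s t') (locate-just row s es)))
    ... | just a  | nothing | just b  = λ e →
      row-compatible a b t (locate-nothing col t et)
        (trans (sym e) (cong (λ s → C s t) (locate-just row s es)))
    ... | just a  | just b  | just b' = IsL₂-row {V = V} V-L a λ b≡b' →
      t≢t' (trans (locate-just col t et) (trans (cong col b≡b') (sym (locate-just col t' et'))))
    columns : ∀ s s' t → s ≢ s' → patch C V s t ≢ patch C V s' t
    columns s s' t s≢s' with locate col t in et | locate row s in es | locate row s' in es'
    ... | _       | nothing | nothing = proj₂ C-L s s' t s≢s'
    ... | nothing | just _  | nothing = proj₂ C-L s s' t s≢s'
    ... | nothing | nothing | just _  = proj₂ C-L s s' t s≢s'
    ... | nothing | just _  | just _  = proj₂ C-L s s' t s≢s'
    ... | just b  | just a  | nothing = λ e →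
      column-compatible a b s' (locate-nothing row s' es')
        (trans e (cong (C s') (locate-just col t et)))
    ... | just b  | nothing | just a  = λ e →
      column-compatible a b s (locate-nothing row s es)
        (trans (sym e) (cong (C s) (locate-just col t et)))
    ... | just b  | just a  | just a' = IsL₂-column {V = V} V-L b λ a≡a' →
      s≢s' (trans (locate-just row s es) (trans (cong row a≡a') (sym (locate-just row s' es'))))

  patch-extends : ∀ {k} {P : PartialColoring n k} {C} V → Extends P C →
                  (∀ a b → P (row a) (col b) ≡ nothing) → Extends P (patch C V)
  patch-extends {P = P} {C} V C-extends uncoloured s t x Pst≡x
    with locate row s in es | locate col t in et
  ... | nothing | _       = C-extends s t x Pst≡x
  ... | just a  | nothing = C-extends s t x Pst≡x
  ... | just a  | just b  with () ← trans (sym Pst≡x)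
        (trans (cong₂ P (locate-just row s es) (locate-just col t et)) (uncoloured a b))

  corners-isL₂ : ∀ {k} {C : Coloring n k} → IsL C → IsL₂ (λ a b → C (row a) (col b))
  corners-isL₂ C-L =
    (λ a → proj₁ C-L (row a) _ _ col-distinct) , (λ b → proj₂ C-L _ _ (col b) row-distinct)

  Fresh : ∀ {k} → Coloring n k → Bool → Bool → Fin k → Set
  Fresh C a b x = (∀ t → t ≢ col (not b) → C (row a) t ≢ x)
                × (∀ s → (∀ a' → s ≢ row a') → C s (col b) ≢ x)

  fresh-≢-corner : ∀ {k} {C : Coloring n k} {a b x} → Fresh C a b x → x ≢ C (row a) (col b)
  fresh-≢-corner {b = true}  (off-row , _) = off-row (col true) col-distinct ∘ sym
  fresh-≢-corner {b = false} (off-row , _) = off-row (col false) (col-distinct ∘ sym) ∘ sym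

  choice-compatible : ∀ {k} {C : Coloring n k} {y V : Bool → Bool → Fin k} → IsL C →
                      (∀ a b → Fresh C a b (y a b)) →
                      (∀ a b → V a b ≡ C (row a) (col b) ⊎ V a b ≡ y a b) → Compatible C V
  choice-compatible {C = C} {y} {V} C-L fresh choice = row-compatible , column-compatible
    where
    row-compatible : ∀ a b t → (∀ b' → t ≢ col b') → V a b ≢ C (row a) t
    row-compatible a b t off-columns e with choice a b
    ... | inj₁ V≡C = proj₁ C-L (row a) (col b) t (off-columns b ∘ sym) (trans (sym V≡C) e)
    ... | inj₂ V≡y = proj₁ (fresh a b) t (off-columns (not b)) (sym (trans (sym V≡y) e))
    column-compatible : ∀ a b s → (∀ a' → s ≢ row a') → V a b ≢ C s (col b)
    column-compatible a b s off-rows e with choice a b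
    ... | inj₁ V≡C = proj₂ C-L (row a) s (col b) (off-rows a ∘ sym) (trans (sym V≡C) e)
    ... | inj₂ V≡y = proj₂ (fresh a b) s off-rows (sym (trans (sym V≡y) e))

2n∸3<2n∸2 : ∀ m → suc m + m < 2 * suc (suc m) ∸ 2
2n∸3<2n∸2 m rewrite +-identityʳ m | +-suc m (suc m) | +-suc m m = ≤-refl

lemma2 : (n : ℕ) → 2 ≤ n → (P : PartialColoring n (2 * n ∸ 2)) → UniquelyExtends P →
    ¬ (Σ (Fin n) λ i → Σ (Fin n) λ i' → Σ (Fin n) λ j → Σ (Fin n) λ j' →
    i ≢ i' × j ≢ j' ×
    P i j ≡ nothing × P i j' ≡ nothing × P i' j ≡ nothing × P i' j' ≡ nothing)
lemma2 (suc (suc m)) (s≤s (s≤s z≤n)) P ((C , C-extends , C-L) , unique)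
       (i , i' , j , j' , i≢i' , j≢j' , Pij , Pij' , Pi'j , Pi'j') =
  no-recolouring (recolouring (corners-isL₂ C-L) (λ a b → fresh-≢-corner {C = C} {a} (fresh a b)))
  where
  row col : Bool → Fin (suc (suc m))
  row a = if a then i else i'
  col b = if b then j else j'
  open Rectangle row col i≢i' j≢j'

  uncoloured : ∀ a b → P (row a) (col b) ≡ nothing
  uncoloured true  true  = Pij
  uncoloured true  false = Pij'
  uncoloured false true  = Pi'j
  uncoloured false false = Pi'j'

  fresh-colour-at : ∀ a b → ∃ (Fresh C a b)
  fresh-colour-at a b
    with x , off-row , off-column ← fresh-colour C (2n∸3<2n∸2 m) (row a) (col (not b)) (col b) i≢i'
    = x , off-row , λ s off-rows → off-column s (off-rows true) (off-rows false)

  y : Bool → Bool → Fin (2 * suc (suc m) ∸ 2)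
  y a b = proj₁ (fresh-colour-at a b)

  fresh : ∀ a b → Fresh C a b (y a b)
  fresh a b = proj₂ (fresh-colour-at a b)

  no-recolouring : Recolouring (λ a b → C (row a) (col b)) y → ⊥
  no-recolouring (V , V-L , choice , a₀ , b₀ , V≡y) =
    fresh-≢-corner {C = C} {a₀} (fresh a₀ b₀) (begin
      y a₀ b₀                       ≡⟨ V≡y ⟨
      V a₀ b₀                       ≡⟨ patch-corner C V a₀ b₀ ⟨
      patch C V (row a₀) (col b₀)   ≡⟨ unique C (patch C V) C-extends C-L
                                         (patch-extends V C-extends uncoloured)
                                         (patch-isL C-L V-L (choice-compatible C-L fresh choice))
                                         (row a₀) (col b₀) ⟨
      C (row a₀) (col b₀)           ∎)
    where open ≡-Reasoning
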